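{- Let $Q$ be a well-founded poset and $n<\omega$. Then $\mathbf{h}(M_n(Q))\ge\mathbf{h}(Q^n)$.
   Context: $Q^n$ carries the product (componentwise) order. $M_n(Q)$ is the set of multisets over $Q$ of size exactly $n$, quasi-ordered by multiset embedding: $\{x_0,\dots,x_{n-1}\}\le\{x'_0,\dots,x'_{p-1}\}$ iff there is an injective $f:n\to p$ with $x_i\le x'_{f(i)}$ for all $i$. For a well-founded quasi-order $X$, $\mathbf{h}(X)$ is the rank of the tree of non-empty strictly decreasing finite sequences of $X$ ordered by strict initial segment $\sqsubset$ (least ordinal $\gamma$ with some $f$ into $\gamma$ such that $s\sqsubset t\implies f(s)>f(t)$). -}

module Defs where

open import Level using (Level; _⊔_; suc)
open import Data.Nat using (ℕ)
open import Data.Fin using (Fin)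
open import Data.List using (List; []; _∷_; _++_)
open import Data.List.Relation.Unary.Linked using (Linked)
open import Data.Product using (Σ; _×_; _,_)
open import Relation.Nullary using (¬_)
open import Relation.Binary.Core using (Rel)
open import Relation.Binary.Bundles using (Poset)
open import Relation.Binary.Structures using (IsStrictTotalOrder)
open import Relation.Binary.PropositionalEquality using (_≡_; _≢_)
open import Relation.Binary.Construct.NonStrictToStrict as NS using ()
open import Induction.WellFounded using (WellFounded)
open import Function.Definitions using (Injective)

record Ordinal (o ℓ : Level) : Set (suc (o ⊔ ℓ)) where
  field
    Carrier : Set o
    _<_     : Rel Carrier ℓ
    isSTO   : IsStrictTotalOrder _≡_ _<_
    wf      : WellFounded _<_

-- Trees of non-empty strictly decreasing finite sequences of a
-- quasi-order (X, ≤), with strict order  x < y  iff  x ≤ y and ¬ y ≤ x.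

module _ {a ℓ : Level} {X : Set a} (_≤_ : Rel X ℓ) where

  _<q_ : Rel X ℓ
  x <q y = (x ≤ y) × ¬ (y ≤ x)

  record DecSeq : Set (a ⊔ ℓ) where
    constructor decseq
    field
      elems    : List X
      nonEmpty : elems ≢ []
      strictly : Linked (λ x y → y <q x) elems

  _⊏_ : Rel DecSeq a
  s ⊏ t = Σ (List X) λ u → (u ≢ []) × (DecSeq.elems t ≡ DecSeq.elems s ++ u)

  RankedBy : {o r : Level} → Ordinal o r → Set (a ⊔ ℓ ⊔ o ⊔ r)
  RankedBy γ = Σ (DecSeq → Ordinal.Carrier γ)
                 λ f → ∀ s t → s ⊏ t → Ordinal._<_ γ (f t) (f s)

-- h(X) ≤ h(Y), where h is the least ordinal admitting a rank function:
-- every ordinal γ bounding the rank of Y's tree also bounds X's.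
HeightLE : {a ℓ b m : Level} (o r : Level)
           {X : Set a} (_≤X_ : Rel X ℓ) {Y : Set b} (_≤Y_ : Rel Y m) →
           Set (a ⊔ ℓ ⊔ b ⊔ m ⊔ suc (o ⊔ r))
HeightLE o r _≤X_ _≤Y_ = (γ : Ordinal o r) → RankedBy _≤Y_ γ → RankedBy _≤X_ γ

WellFoundedPoset : {c ℓ₁ ℓ₂ : Level} → Poset c ℓ₁ ℓ₂ → Set (c ⊔ ℓ₁ ⊔ ℓ₂)
WellFoundedPoset P = WellFounded (NS._<_ (Poset._≈_ P) (Poset._≤_ P))

-- Q^n with the product order, and M_n(Q) (multisets of size n,
-- represented by n-tuples) with the multiset-embedding quasi-order.

module _ {c ℓ₁ ℓ₂ : Level} (Q : Poset c ℓ₁ ℓ₂) (n : ℕ) where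
  open Poset Q renaming (Carrier to |Q|)

  _≤ᵖ_ : Rel (Fin n → |Q|) ℓ₂
  x ≤ᵖ y = ∀ i → x i ≤ y i

  _≤ᵐ_ : Rel (Fin n → |Q|) ℓ₂
  x ≤ᵐ y = Σ (Fin n → Fin n) λ f → Injective _≡_ _≡_ f × (∀ i → x i ≤ y (f i))

module Submission where

-- Both Q^n and M_n(Q) live on the same carrier, the n-tuples
-- Fin n → Q, and the identity map is strictly monotone from the product
-- order to the multiset order: if x ≤ y componentwise but y ≰ x, then
-- x ≤ y as multisets (via the identity injection), and y ≤ x as multisets
-- would force y ≤ x componentwise.  The last point is a cycle argument:
-- if y i ≤ x (f i) for an injection f of Fin n, then y i ≤ x (f i) ≤ y (f i),
-- so y increases along every orbit of f; every orbit is a cycle, so going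
-- once around the cycle from j gives y j ≤ x j.
--
-- The theorem follows by combining the last two facts; the argument does
-- not need well-foundedness of Q, nor antisymmetry (only a preorder).

open import Defs
open import Level using (Level; _⊔_)
open import Data.Nat using (ℕ; zero; suc; _+_)
open import Data.Nat.Properties using (n<1+n; +-comm; m≤n⇒∃[o]m+o≡n)
open import Data.Nat.GeneralisedArithmetic using (iterate)
open import Data.Fin using (Fin; toℕ)
open import Data.Fin.Properties using (pigeonhole)
open import Data.Product using (∃; _,_)
open import Data.List.Relation.Unary.Linked as Linked using ()
open import Relation.Nullary using (¬_)
open import Function.Definitions using (Injective)
open import Relation.Binary.Core using (Rel)
open import Relation.Binary.Bundles using (Preorder; Poset)
open import Relation.Binary.PropositionalEquality
  using (_≡_; refl; sym; trans; cong; subst; module ≡-Reasoning)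

module Orbits {n : ℕ} (f : Fin n → Fin n) (f-inj : Injective _≡_ _≡_ f) where

  iterate-+ : ∀ p q j → iterate f j (p + q) ≡ iterate f (iterate f j p) q
  iterate-+ zero    q j = refl
  iterate-+ (suc p) q j = iterate-+ p q (f j)

  iterate-suc : ∀ k j → iterate f j (suc k) ≡ f (iterate f j k)
  iterate-suc zero    j = refl
  iterate-suc (suc k) j = iterate-suc k (f j)

  iterate-inj : ∀ k {i j} → iterate f i k ≡ iterate f j k → i ≡ j
  iterate-inj zero    e = e
  iterate-inj (suc k) e = f-inj (iterate-inj k e)

  -- Among f^0 j, …, f^n j two coincide (pigeonhole), say f^a j = f^(a+1+d) j;
  -- cancelling f^a by injectivity gives f^(d+1) j = j.
  periodic : ∀ j → ∃ λ d → iterate f j (suc d) ≡ j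
  periodic j with pigeonhole (n<1+n n) (λ k → iterate f j (toℕ k))
  ... | a , b , a<b , fᵃj≡fᵇj with m≤n⇒∃[o]m+o≡n a<b
  ... | d , a+1+d≡b = d , iterate-inj (toℕ a) (begin
        iterate f (iterate f j (suc d)) (toℕ a) ≡⟨ iterate-+ (suc d) (toℕ a) j ⟨
        iterate f j (suc d + toℕ a)             ≡⟨ cong (iterate f j) (cong suc (+-comm d (toℕ a))) ⟩
        iterate f j (suc (toℕ a) + d)           ≡⟨ cong (iterate f j) a+1+d≡b ⟩
        iterate f j (toℕ b)                     ≡⟨ fᵃj≡fᵇj ⟨
        iterate f j (toℕ a)                     ∎)
    where open ≡-Reasoning

module _ {c ℓ₁ ℓ₂ : Level} (P : Preorder c ℓ₁ ℓ₂) where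
  open Preorder P renaming (Carrier to A; refl to ≲-refl; trans to ≲-trans)

  cyclic-domination : ∀ {n} (x y : Fin n → A) (f : Fin n → Fin n) →
    Injective _≡_ _≡_ f → (∀ i → x i ≲ y i) → (∀ i → y i ≲ x (f i)) →
    ∀ j → y j ≲ x j
  cyclic-domination x y f f-inj x≲y y≲xf j = around-cycle (periodic j)
    where
    open Orbits f f-inj
    -- y i ≲ x (f i) ≲ y (f i), so y increases along the orbit of j
    climb : ∀ k i → y i ≲ y (iterate f i k)
    climb zero    i = ≲-refl
    climb (suc k) i = ≲-trans (≲-trans (y≲xf i) (x≲y (f i))) (climb k (f i))
    -- if f^(d+1) j = j then y j ≲ y (f^d j) ≲ x (f^(d+1) j) = x j
    around-cycle : (∃ λ d → iterate f j (suc d) ≡ j) → y j ≲ x j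
    around-cycle (d , cycle) =
      ≲-trans (climb d j) (subst (λ i → y (iterate f j d) ≲ x i) returns (y≲xf (iterate f j d)))
      where
      returns : f (iterate f j d) ≡ j
      returns = trans (sym (iterate-suc d j)) cycle

module _ {c ℓ₁ ℓ₂ : Level} (Q : Poset c ℓ₁ ℓ₂) (n : ℕ) where
  open Poset Q using (preorder)

  product<⇒multiset< : ∀ {x y} → _<q_ (_≤ᵖ_ Q n) x y → _<q_ (_≤ᵐ_ Q n) x y
  product<⇒multiset< {x} {y} (x≤y , y≰x) = ((λ i → i) , (λ e → e) , x≤y) , y≰ᵐx
    where
    y≰ᵐx : ¬ _≤ᵐ_ Q n y x
    y≰ᵐx (f , f-inj , y≤xf) = y≰x (cyclic-domination preorder x y f f-inj x≤y y≤xf)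

-- Refining the strict order on a fixed carrier can only increase the height:
-- decreasing sequences for the coarser order remain decreasing for the finer
-- one, with the same underlying lists, so a rank function of the finer tree
-- restricts to one of the coarser tree.
refine-height : ∀ {a ℓ m} (o r : Level) {X : Set a} (_≤₁_ : Rel X ℓ) (_≤₂_ : Rel X m) →
  (∀ {x y} → _<q_ _≤₁_ x y → _<q_ _≤₂_ x y) → HeightLE o r _≤₁_ _≤₂_
refine-height o r _≤₁_ _≤₂_ refines γ (rank , rank-decreasing) =
  (λ s → rank (embed s)) , λ s t s⊏t → rank-decreasing (embed s) (embed t) s⊏t
  where
  embed : DecSeq _≤₁_ → DecSeq _≤₂_
  embed (decseq xs nonEmpty decreasing) = decseq xs nonEmpty (Linked.map refines decreasing)

lemma4p25 : ∀ {c ℓ₁ ℓ₂} (Q : Poset c ℓ₁ ℓ₂) → WellFoundedPoset Q → (n : ℕ) →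
    HeightLE (c ⊔ ℓ₁ ⊔ ℓ₂) (c ⊔ ℓ₁ ⊔ ℓ₂) (_≤ᵖ_ Q n) (_≤ᵐ_ Q n)
lemma4p25 {c} {ℓ₁} {ℓ₂} Q _ n =
  refine-height (c ⊔ ℓ₁ ⊔ ℓ₂) (c ⊔ ℓ₁ ⊔ ℓ₂) (_≤ᵖ_ Q n) (_≤ᵐ_ Q n) (product<⇒multiset< Q n)
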